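{- Let $q$ be a prime power, $X$ a subspace of $\mathbb{F}_q^n$, $M=\mathcal{RE}(X)$ (a $k\times n$ matrix), and $\Psi(X)=s_1s_2\cdots s_n$. Then for every $j\in[n]$: (i) $s_j=H$ if and only if column $j$ of $M$ is inessential; (ii) $s_j=U$ if and only if column $j$ is essential and pivotal; (iii) $s_j=D$ if and only if column $j$ is essential and nonpivotal.
   Context: Vectors in $\mathbb{F}_q^n$ are row vectors, $e_1,\dots,e_n$ the standard basis. $\mathcal{L}(X)=\{j: e_j+\sum_{i>j}\alpha_i e_i\in X\text{ for some }\alpha_i\}$, $\mathcal{R}(X)=\{j: e_j+\sum_{i<j}\alpha_i e_i\in X\text{ for some }\alpha_i\}$, and $\Psi(X)=s_1\cdots s_n$ with $s_i=U$ if $i\in\mathcal{L}(X)\setminus\mathcal{R}(X)$, $s_i=D$ if $i\in\mathcal{R}(X)\setminus\mathcal{L}(X)$, $s_i=H$ otherwise. A $k\times n$ matrix is in row reduced echelon form (rref) if every row is nonzero with first nonzero entry equal to $1$, located in column $p_i$ for row $i$, with $p_1<\cdots<p_k$, and columns $p_1,\dots,p_k$ form the $k\times k$ identity matrix; $p_1,\dots,p_k$ are the pivotal columns, the others nonpivotal. $\mathcal{RE}(X)$ is the unique $k\times n$ rref ($k=\dim X$) whose row space is $X$. Write $R[i]$ for row $i$ of $M$, $C[j]$ for column $j$, $C_m[j]$ for the column vector of the first $m$ entries of $C[j]$, and $R_r[i]$ for the row vector of the last $r$ entries of $R[i]$. Column $j$ is essential if: when $j$ is nonpivotal, with $m$ the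 unique integer such that $p_m<j<p_{m+1}$ (where $p_0=0$, $p_{k+1}=n+1$), $C_m[j]\notin\operatorname{span}\{C_m[j+1],\dots,C_m[n]\}$; when $j=p_m$ is pivotal, $R_{n-j}[m]\notin\operatorname{span}\{R_{n-j}[1],\dots,R_{n-j}[m-1]\}$. (Empty vectors lie in every span.) Otherwise column $j$ is inessential. -}

module Defs where

open import Level using (Level; _⊔_) renaming (suc to lsuc)
open import Data.Nat using (ℕ; _^_) renaming (suc to nsuc)
open import Data.Nat.Primality using (Prime)
open import Data.Fin using (Fin; zero; suc; _<_; _≤_)
open import Data.Product using (Σ; ∃; ∃-syntax; _×_; _,_)
open import Data.Sum using (_⊎_)
open import Relation.Nullary using (¬_)
open import Relation.Binary.PropositionalEquality as ≡ using (_≡_; _≢_)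
open import Function using (_∘_)
open import Function.Bundles using (Inverse)
open import Algebra.Bundles using (CommutativeRing)

IsPrimePower : ℕ → Set
IsPrimePower q = ∃[ p ] ∃[ e ] (Prime p × q ≡ p ^ nsuc e)

record FiniteField (q : ℕ) (c ℓ : Level) : Set (lsuc (c ⊔ ℓ)) where
  field
    commutativeRing : CommutativeRing c ℓ
  open CommutativeRing commutativeRing public
  field
    0≉1      : ¬ (0# ≈ 1#)
    inverse  : ∀ x → ¬ (x ≈ 0#) → ∃[ y ] (x * y ≈ 1#)
    enumerate : Inverse setoid (≡.setoid (Fin q))

module _ {q : ℕ} {c ℓ : Level} (F : FiniteField q c ℓ) where
  open FiniteField F hiding (zero)

  Vect : ℕ → Set c
  Vect n = Fin n → Carrier

  Matrix : ℕ → ℕ → Set c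
  Matrix k n = Fin k → Fin n → Carrier

  sumF : ∀ {k} → (Fin k → Carrier) → Carrier
  sumF {ℕ.zero}   f = 0#
  sumF {nsuc k}   f = f zero + sumF (f ∘ suc)

  record IsSubspace {n : ℕ} {ℓx : Level} (X : Vect n → Set ℓx) : Set (c ⊔ ℓ ⊔ ℓx) where
    field
      respects : ∀ {u v} → (∀ j → u j ≈ v j) → X u → X v
      has-zero : X (λ _ → 0#)
      +-closed : ∀ {u v} → X u → X v → X (λ j → u j + v j)
      *-closed : ∀ a {u} → X u → X (λ j → a * u j)

  RowSpace : ∀ {k n} → Matrix k n → Vect n → Set (c ⊔ ℓ)
  RowSpace {k} M v = Σ (Fin k → Carrier) λ γ → (∀ j → v j ≈ sumF {k} (λ i → γ i * M i j))

  LSet : ∀ {n ℓx} → (Vect n → Set ℓx) → Fin n → Set (c ⊔ ℓ ⊔ ℓx)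
  LSet {n} X j = Σ (Vect n) λ v → (X v × v j ≈ 1# × (∀ i → i < j → v i ≈ 0#))

  RSet : ∀ {n ℓx} → (Vect n → Set ℓx) → Fin n → Set (c ⊔ ℓ ⊔ ℓx)
  RSet {n} X j = Σ (Vect n) λ v → (X v × v j ≈ 1# × (∀ i → j < i → v i ≈ 0#))

  data Letter : Set where
    U D H : Letter

  -- Ψ(X) = s_1 ⋯ s_n ; "s_j = s" is  PsiAt X j s
  PsiAt : ∀ {n ℓx} → (Vect n → Set ℓx) → Fin n → Letter → Set (c ⊔ ℓ ⊔ ℓx)
  PsiAt X j U = LSet X j × ¬ RSet X j
  PsiAt X j D = RSet X j × ¬ LSet X j
  PsiAt X j H = ¬ (LSet X j × ¬ RSet X j) × ¬ (RSet X j × ¬ LSet X j)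

  record IsRREF {k n : ℕ} (M : Matrix k n) : Set (c ⊔ ℓ) where
    field
      pivot       : Fin k → Fin n
      pivot-mono  : ∀ i i' → i < i' → pivot i < pivot i'
      pivot-one   : ∀ i → M i (pivot i) ≈ 1#
      leading-0   : ∀ i j → j < pivot i → M i j ≈ 0#
      pivot-col   : ∀ i i' → i' ≢ i → M i' (pivot i) ≈ 0#

  module _ {k n : ℕ} {M : Matrix k n} (r : IsRREF M) where
    open IsRREF r

    Pivotal : Fin n → Set
    Pivotal j = ∃[ m ] (pivot m ≡ j)

    NonPivotal : Fin n → Set
    NonPivotal j = ¬ Pivotal j

    -- C_m[j] ∈ span{C_m[j+1],…,C_m[n]}, where the first m rows are exactly the
    -- rows whose pivot lies before column j
    ColInSpan : Fin n → Set (c ⊔ ℓ)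
    ColInSpan j = Σ (Fin n → Carrier) λ β → ((∀ j' → j' ≤ j → β j' ≈ 0#)
                        × (∀ i → pivot i < j → M i j ≈ sumF {n} (λ j' → β j' * M i j')))

    -- R_{n-j}[m] ∈ span{R_{n-j}[1],…,R_{n-j}[m-1]}  (entries in columns after j)
    RowInSpan : Fin k → Fin n → Set (c ⊔ ℓ)
    RowInSpan m j = Σ (Fin k → Carrier) λ γ → ((∀ i → ¬ (i < m) → γ i ≈ 0#)
                          × (∀ j' → j < j' → M m j' ≈ sumF {k} (λ i → γ i * M i j')))

    Essential : Fin n → Set (c ⊔ ℓ)
    Essential j = (NonPivotal j × ¬ ColInSpan j)
                ⊎ (∃[ m ] (pivot m ≡ j × ¬ RowInSpan m j))

    Inessential : Fin n → Set (c ⊔ ℓ)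
    Inessential j = ¬ Essential j

module Submission where

open import Defs
open import Level using (Level; _⊔_)
open import Data.Nat using (ℕ; zero; suc)
import Data.Nat.Properties as ℕ
open import Data.Fin as Fin using (Fin; zero; suc; punchIn; _<_; _≤_)
open import Data.Fin.Properties using (punchInᵢ≢i; all?; any?; ¬∀⟶∃¬; <-cmp; <⇒≢; <-irrefl)
open import Data.Vec.Functional using (Vector; _∷_; removeAt)
open import Data.Product using (∃-syntax; _×_; _,_; proj₁)
open import Data.Sum as Sum using (_⊎_; inj₁; inj₂; [_,_]′)
open import Function using (_∘_)
open import Function.Bundles using (_⇔_; mk⇔; Equivalence)
open import Function.Properties.Inverse using (Inverse⇒Injection)
open import Relation.Nullary using (¬_; Dec; yes; no; contradiction)
open import Relation.Nullary.Decidable using (via-injection)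
open import Relation.Binary.Definitions using (Decidable; tri<; tri≈; tri>)
import Relation.Binary.PropositionalEquality as ≡
open ≡ using (_≡_; _≢_)
open import Algebra.Bundles using (CommutativeRing)

-- Every vector of X is a combination γᵀM of the rows of M, and since the pivot columns of M form
-- an identity matrix, the coefficient γ m is the entry of the vector at the pivot column p_m.
-- Consequently a vector of X starting at column j exists iff j is pivotal, so L(X) is the set of
-- pivotal columns. A vector of X ending at the pivot p_m has γ m = 1 and γ i = 0 for i > m, so it
-- exists iff the tail of row m after p_m is a combination of the tails of the earlier rows. A
-- vector of X ending at a nonpivotal column j only involves the first m rows (those with pivots
-- before j); it exists iff some functional on F^m takes the value 1 at C_m[j] and vanishes at
-- C_m[j+1], …, C_m[n], which by the Fredholm alternative (Gaussian elimination over a field)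
-- happens iff C_m[j] is not in their span.

module LinearAlgebra {c ℓ} (R : CommutativeRing c ℓ) where
  open CommutativeRing R hiding (zero)
  open import Algebra.Properties.Ring ring using (-1*x≈-x; -0#≈0#; x[y-z]≈xy-xz; [y-z]x≈yx-zx)
  open import Algebra.Properties.Semiring.Sum semiring
    using (sum; sum-cong-≋; sum-replicate-zero; sum-remove; ∑-distrib-+; ∑-comm; *-distribˡ-sum)
  open import Algebra.Properties.CommutativeSemigroup *-commutativeSemigroup 
    using (x∙yz≈y∙xz; xy∙z≈zy∙x; xy∙z≈zx∙y; xy∙z≈yz∙x)
  open import Algebra.Properties.CommutativeSemigroup +-commutativeSemigroup using ()
    renaming (xy∙z≈zy∙x to +-rearrange)
  open import Relation.Binary.Reasoning.Setoid setoid

  when : ∀ {p} {P : Set p} → Dec P → Carrier → Carrier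
  when (yes _) x = x
  when (no _)  _ = 0#

  when-yes : ∀ {p} {P : Set p} (P? : Dec P) {x} → P → when P? x ≈ x
  when-yes (yes _) _ = refl
  when-yes (no ¬p) p = contradiction p ¬p

  when-no : ∀ {p} {P : Set p} (P? : Dec P) {x} → ¬ P → when P? x ≈ 0#
  when-no (yes p) ¬p = contradiction p ¬p
  when-no (no _)  _  = refl

  when-cong : ∀ {p} {P : Set p} (P? : Dec P) {x y} → x ≈ y → when P? x ≈ when P? y
  when-cong (yes _) x≈y = x≈y
  when-cong (no _)  _   = refl

  when-*-comm : ∀ {p} {P : Set p} (P? : Dec P) x y → when P? x * y ≈ x * when P? y
  when-*-comm (yes _) x y = refl
  when-*-comm (no _)  x y = trans (zeroˡ y) (sym (zeroʳ x))

  unit : ∀ {k} → Fin k → Vector Carrier k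
  unit m i = when (i Fin.≟ m) 1#

  x-0≈x : ∀ x → x - 0# ≈ x
  x-0≈x x = trans (+-congˡ -0#≈0#) (+-identityʳ x)

  sum-zero : ∀ {k} {f : Vector Carrier k} → (∀ i → f i ≈ 0#) → sum f ≈ 0#
  sum-zero {k} f≈0 = trans (sum-cong-≋ f≈0) (sum-replicate-zero k)

  sum-single : ∀ {k} (f : Vector Carrier k) m → (∀ i → i ≢ m → f i ≈ 0#) → sum f ≈ f m
  sum-single {suc _} f m others≈0 = begin
    sum f                     ≈⟨ sum-remove {i = m} f ⟩
    f m + sum (removeAt f m)  ≈⟨ +-congˡ (sum-zero (λ i → others≈0 (punchIn m i) (punchInᵢ≢i m i))) ⟩
    f m + 0#                  ≈⟨ +-identityʳ (f m) ⟩
    f m                       ∎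

  sum-neg : ∀ {k} (f : Vector Carrier k) → sum (λ i → - f i) ≈ - sum f
  sum-neg f = begin
    sum (λ i → - f i)       ≈⟨ sum-cong-≋ (λ i → -1*x≈-x (f i)) ⟨
    sum (λ i → - 1# * f i)  ≈⟨ *-distribˡ-sum (- 1#) f ⟨
    - 1# * sum f            ≈⟨ -1*x≈-x (sum f) ⟩
    - sum f                 ∎

  infix 8 _∙_
  _∙_ : ∀ {k} → Vector Carrier k → Vector Carrier k → Carrier
  x ∙ y = sum (λ i → x i * y i)

  ∙-congˡ : ∀ {k} (x : Vector Carrier k) {y y′} → (∀ i → y i ≈ y′ i) → x ∙ y ≈ x ∙ y′
  ∙-congˡ x y≈y′ = sum-cong-≋ (λ i → *-congˡ (y≈y′ i))

  ∙-zeroʳ : ∀ {k} (x : Vector Carrier k) {y} → (∀ i → y i ≈ 0#) → x ∙ y ≈ 0#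
  ∙-zeroʳ x y≈0 = sum-zero (λ i → trans (*-congˡ (y≈0 i)) (zeroʳ (x i)))

  ∙-comm : ∀ {k} (x y : Vector Carrier k) → x ∙ y ≈ y ∙ x
  ∙-comm x y = sum-cong-≋ (λ i → *-comm (x i) (y i))

  ∙-*ʳ : ∀ {k} (x y : Vector Carrier k) a → x ∙ (λ i → a * y i) ≈ a * (x ∙ y)
  ∙-*ʳ x y a = begin
    x ∙ (λ i → a * y i)      ≈⟨ sum-cong-≋ (λ i → x∙yz≈y∙xz (x i) a (y i)) ⟩
    sum (λ i → a * (x i * y i)) ≈⟨ *-distribˡ-sum a (λ i → x i * y i) ⟨
    a * (x ∙ y)              ∎

  ∙-*ˡ : ∀ {k} (x y : Vector Carrier k) a → (λ i → a * x i) ∙ y ≈ a * (x ∙ y)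
  ∙-*ˡ x y a = trans (∙-comm _ y) (trans (∙-*ʳ y x a) (*-congˡ (∙-comm y x)))

  ∙-minusʳ : ∀ {k} (x y z : Vector Carrier k) → x ∙ (λ i → y i - z i) ≈ x ∙ y - x ∙ z
  ∙-minusʳ x y z = begin
    x ∙ (λ i → y i - z i)                      ≈⟨ sum-cong-≋ (λ i → x[y-z]≈xy-xz (x i) (y i) (z i)) ⟩
    sum (λ i → x i * y i - x i * z i)          ≈⟨ ∑-distrib-+ (λ i → x i * y i) (λ i → - (x i * z i)) ⟩
    x ∙ y + sum (λ i → - (x i * z i))          ≈⟨ +-congˡ (sum-neg (λ i → x i * z i)) ⟩
    x ∙ y - x ∙ z                              ∎

  ∙-minusˡ : ∀ {k} (x y z : Vector Carrier k) → (λ i → x i - y i) ∙ z ≈ x ∙ z - y ∙ z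
  ∙-minusˡ x y z = trans (∙-comm _ z) (trans (∙-minusʳ z x y) (+-cong (∙-comm z x) (-‿cong (∙-comm z y))))

  ∙-unitˡ : ∀ {k} m (y : Vector Carrier k) → unit m ∙ y ≈ y m
  ∙-unitˡ m y = begin
    unit m ∙ y        ≈⟨ sum-single _ m (λ i i≢m → trans (*-congʳ (when-no (i Fin.≟ m) i≢m)) (zeroˡ (y i))) ⟩
    unit m m * y m    ≈⟨ *-congʳ (when-yes (m Fin.≟ m) ≡.refl) ⟩
    1# * y m          ≈⟨ *-identityˡ (y m) ⟩
    y m               ∎

  ∙-unitʳ : ∀ {k} (x : Vector Carrier k) m → x ∙ unit m ≈ x m
  ∙-unitʳ x m = trans (∙-comm x (unit m)) (∙-unitˡ m x)

  ∙-transpose : ∀ {k t} (β : Vector Carrier t) (γ : Vector Carrier k) (A : Fin k → Fin t → Carrier) →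
                β ∙ (λ s → γ ∙ (λ i → A i s)) ≈ γ ∙ (λ i → β ∙ A i)
  ∙-transpose β γ A = begin
    β ∙ (λ s → γ ∙ (λ i → A i s))                 ≈⟨ sum-cong-≋ (λ s → *-distribˡ-sum (β s) (λ i → γ i * A i s)) ⟩
    sum (λ s → sum (λ i → β s * (γ i * A i s)))   ≈⟨ ∑-comm (λ i s → β s * (γ i * A i s)) ⟨
    sum (λ i → sum (λ s → β s * (γ i * A i s)))   ≈⟨ sum-cong-≋ (λ i → sum-cong-≋ (λ s → x∙yz≈y∙xz (β s) (γ i) (A i s))) ⟩
    sum (λ i → sum (λ s → γ i * (β s * A i s)))   ≈⟨ sum-cong-≋ (λ i → *-distribˡ-sum (γ i) (λ s → β s * A i s)) ⟨
    γ ∙ (λ i → β ∙ A i)                           ∎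

  InSpan : ∀ {k t} → (Fin t → Vector Carrier k) → Vector Carrier k → Set (c ⊔ ℓ)
  InSpan W u = ∃[ β ] ∀ i → u i ≈ β ∙ (λ s → W s i)

  Separable : ∀ {k t} → (Fin t → Vector Carrier k) → Vector Carrier k → Set (c ⊔ ℓ)
  Separable W u = ∃[ γ ] (γ ∙ u ≈ 1# × ∀ s → γ ∙ W s ≈ 0#)

  module _ {k t} (W : Fin (suc t) → Vector Carrier k) (W₀≈0 : ∀ i → W zero i ≈ 0#) where

    inSpan-extend-zero : ∀ {u} → InSpan (W ∘ suc) u → InSpan W u
    inSpan-extend-zero (β , u≈βW) =
      0# ∷ β , λ i → trans (u≈βW i) (sym (trans (+-congʳ (zeroˡ (W zero i))) (+-identityˡ _)))

    separable-extend-zero : ∀ {u} → Separable (W ∘ suc) u → Separable W u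
    separable-extend-zero (γ , γu≈1 , γW≈0) = γ , γu≈1 , λ { zero → ∙-zeroʳ γ W₀≈0 ; (suc s) → γW≈0 s }

  -- One step of Gaussian elimination: eliminate clears coordinate r using w = W zero, and
  -- spanning coefficients and separating functionals for the eliminated family lift back to W.
  module Elimination {k t} (W : Fin (suc t) → Vector Carrier k) (r : Fin k) (y : Carrier)
                     (W₀ᵣy≈1 : W zero r * y ≈ 1#) where

    private
      w : Vector Carrier k
      w = W zero

    eliminate : Vector Carrier k → Vector Carrier k
    eliminate x i = x i - (x r * y) * w i

    eliminate-w≈0 : ∀ i → eliminate w i ≈ 0#
    eliminate-w≈0 i = trans (+-congˡ (-‿cong (trans (*-congʳ W₀ᵣy≈1) (*-identityˡ (w i))))) (-‿inverseʳ (w i))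

    ∙-eliminate : ∀ γ x → γ ∙ eliminate x ≈ (λ i → γ i - (γ ∙ w * y) * unit r i) ∙ x
    ∙-eliminate γ x = begin
      γ ∙ eliminate x                                ≈⟨ ∙-minusʳ γ x _ ⟩
      γ ∙ x - γ ∙ (λ i → (x r * y) * w i)            ≈⟨ +-congˡ (-‿cong (∙-*ʳ γ w (x r * y))) ⟩
      γ ∙ x - (x r * y) * (γ ∙ w)                    ≈⟨ +-congˡ (-‿cong (xy∙z≈zy∙x (x r) y (γ ∙ w))) ⟩
      γ ∙ x - (γ ∙ w * y) * x r                      ≈⟨ +-congˡ (-‿cong (*-congˡ (∙-unitˡ r x))) ⟨
      γ ∙ x - (γ ∙ w * y) * (unit r ∙ x)             ≈⟨ +-congˡ (-‿cong (∙-*ˡ (unit r) x _)) ⟨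
      γ ∙ x - (λ i → (γ ∙ w * y) * unit r i) ∙ x     ≈⟨ ∙-minusˡ γ _ x ⟨
      (λ i → γ i - (γ ∙ w * y) * unit r i) ∙ x       ∎

    separable-unelim : ∀ {u} → Separable (eliminate ∘ W ∘ suc) (eliminate u) → Separable W u
    separable-unelim {u} (γ , γu≈1 , γW≈0) = γ′ , trans (sym (∙-eliminate γ u)) γu≈1 , γ′W≈0
      where
      γ′ = λ i → γ i - (γ ∙ w * y) * unit r i
      γ′W≈0 : ∀ s → γ′ ∙ W s ≈ 0#
      γ′W≈0 zero    = trans (sym (∙-eliminate γ w)) (∙-zeroʳ γ eliminate-w≈0)
      γ′W≈0 (suc s) = trans (sym (∙-eliminate γ (W (suc s)))) (γW≈0 s)

    eliminate-restore : ∀ x i → eliminate x i + (x r * y) * w i ≈ x i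
    eliminate-restore x i = begin
      (x i - a) + a     ≈⟨ +-assoc (x i) (- a) a ⟩
      x i + (- a + a)   ≈⟨ +-congˡ (-‿inverseˡ a) ⟩
      x i + 0#          ≈⟨ +-identityʳ (x i) ⟩
      x i               ∎
      where a = (x r * y) * w i

    inSpan-unelim : ∀ {u} → InSpan (eliminate ∘ W ∘ suc) (eliminate u) → InSpan W u
    inSpan-unelim {u} (β , u≈βW) = (u r - B) * y ∷ β , λ i → begin
        u i                                               ≈⟨ eliminate-restore u i ⟨
        eliminate u i + (u r * y) * w i                   ≈⟨ +-congʳ (trans (u≈βW i) (∙-eliminate-column i)) ⟩
        (β ∙ column i - (y * w i) * B) + (u r * y) * w i  ≈⟨ rearrange i ⟩
        ((u r - B) * y) * w i + β ∙ column i              ∎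
      where
      column : Fin k → Vector Carrier t
      column i s = W (suc s) i
      B = β ∙ column r
      ∙-eliminate-column : ∀ i → β ∙ (λ s → eliminate (W (suc s)) i) ≈ β ∙ column i - (y * w i) * B
      ∙-eliminate-column i = begin
        β ∙ (λ s → eliminate (W (suc s)) i)                 ≈⟨ ∙-minusʳ β (column i) _ ⟩
        β ∙ column i - β ∙ (λ s → (column r s * y) * w i)    ≈⟨ +-congˡ (-‿cong (∙-congˡ β (λ s → xy∙z≈yz∙x (column r s) y (w i)))) ⟩
        β ∙ column i - β ∙ (λ s → (y * w i) * column r s)    ≈⟨ +-congˡ (-‿cong (∙-*ʳ β (column r) (y * w i))) ⟩
        β ∙ column i - (y * w i) * B                         ∎
      rearrange : ∀ i → (β ∙ column i - (y * w i) * B) + (u r * y) * w i ≈ ((u r - B) * y) * w i + β ∙ column i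
      rearrange i = begin
        (β ∙ column i - (y * w i) * B) + (u r * y) * w i   ≈⟨ +-rearrange (β ∙ column i) _ _ ⟩
        ((u r * y) * w i - (y * w i) * B) + β ∙ column i   ≈⟨ +-congʳ (+-congˡ (-‿cong (xy∙z≈zx∙y y (w i) B))) ⟩
        ((u r * y) * w i - (B * y) * w i) + β ∙ column i   ≈⟨ +-congʳ ([y-z]x≈yx-zx (w i) _ _) ⟨
        (u r * y - B * y) * w i + β ∙ column i             ≈⟨ +-congʳ (*-congʳ ([y-z]x≈yx-zx y _ _)) ⟨
        ((u r - B) * y) * w i + β ∙ column i               ∎

  module _ (_≈?_ : Decidable _≈_) (inverse : ∀ x → ¬ x ≈ 0# → ∃[ y ] x * y ≈ 1#) where

    nonzero-separable : ∀ {k} (W : Fin 0 → Vector Carrier k) {u} i → ¬ u i ≈ 0# → Separable W u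
    nonzero-separable W {u} i uᵢ≉0 with inverse (u i) uᵢ≉0
    ... | y , uᵢy≈1 = (λ i′ → y * unit i i′) , γu≈1 , λ ()
      where
      γu≈1 : (λ i′ → y * unit i i′) ∙ u ≈ 1#
      γu≈1 = begin
        (λ i′ → y * unit i i′) ∙ u  ≈⟨ ∙-*ˡ (unit i) u y ⟩
        y * (unit i ∙ u)            ≈⟨ *-congˡ (∙-unitˡ i u) ⟩
        y * u i                     ≈⟨ *-comm y (u i) ⟩
        u i * y                     ≈⟨ uᵢy≈1 ⟩
        1#                          ∎

    inSpan⊎separable : ∀ {k} t (W : Fin t → Vector Carrier k) u → InSpan W u ⊎ Separable W u
    inSpan⊎separable zero W u with all? (λ i → u i ≈? 0#)
    ... | yes u≈0 = inj₁ ((λ ()) , u≈0)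
    ... | no u≉0 with ¬∀⟶∃¬ _ _ (λ i → u i ≈? 0#) u≉0
    ...   | i , uᵢ≉0 = inj₂ (nonzero-separable W i uᵢ≉0)
    inSpan⊎separable (suc t) W u with all? (λ i → W zero i ≈? 0#)
    ... | yes W₀≈0 = Sum.map (inSpan-extend-zero W W₀≈0) (separable-extend-zero W W₀≈0)
                             (inSpan⊎separable t (W ∘ suc) u)
    ... | no W₀≉0 with ¬∀⟶∃¬ _ _ (λ i → W zero i ≈? 0#) W₀≉0
    ...   | r , W₀ᵣ≉0 with inverse (W zero r) W₀ᵣ≉0
    ...     | y , W₀ᵣy≈1 = Sum.map inSpan-unelim separable-unelim
                                   (inSpan⊎separable t (eliminate ∘ W ∘ suc) (eliminate u))
      where open Elimination W r y W₀ᵣy≈1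

module _ {q c ℓ} (F : FiniteField q c ℓ) where
  open FiniteField F hiding (zero)
  open LinearAlgebra commutativeRing
  open import Algebra.Properties.Semiring.Sum semiring using (sum; sum-cong-≋)
  open import Relation.Binary.Reasoning.Setoid setoid

  _≈?_ : Decidable _≈_
  _≈?_ = via-injection (Inverse⇒Injection enumerate) Fin._≟_

  sumF≡sum : ∀ {k} (f : Vector Carrier k) → sumF F f ≡ sum f
  sumF≡sum {zero}  f = ≡.refl
  sumF≡sum {suc k} f = ≡.cong (f zero +_) (sumF≡sum (f ∘ suc))

  sumF≈∙ : ∀ {k} (x y : Vector Carrier k) → sumF F (λ i → x i * y i) ≈ x ∙ y
  sumF≈∙ x y = reflexive (sumF≡sum (λ i → x i * y i))

  module Echelon {ℓx n k} (X : Vect F n → Set ℓx) {M : Matrix F k n} (r : IsRREF F M)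
                 (X⇔rowSpace : ∀ v → X v ⇔ RowSpace F M v) where
    open IsRREF r

    column : Fin n → Vector Carrier k
    column j i = M i j

    combination∈X : ∀ γ → X (λ j → γ ∙ column j)
    combination∈X γ = Equivalence.from (X⇔rowSpace _) (γ , λ j → sym (sumF≈∙ γ (column j)))

    ∈X⇒combination : ∀ {v : Vect F n} → X v → ∃[ γ ] ∀ j → v j ≈ γ ∙ column j
    ∈X⇒combination v∈X with Equivalence.to (X⇔rowSpace _) v∈X
    ... | γ , v≈γM = γ , λ j → trans (v≈γM j) (sumF≈∙ γ (column j))

    column-pivot≈unit : ∀ m i → M i (pivot m) ≈ unit m i
    column-pivot≈unit m i with i Fin.≟ m
    ... | yes ≡.refl = pivot-one m
    ... | no i≢m     = pivot-col m i i≢m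

    ∙-column-pivot : ∀ γ m → γ ∙ column (pivot m) ≈ γ m
    ∙-column-pivot γ m = trans (∙-congˡ γ (column-pivot≈unit m)) (∙-unitʳ γ m)

    coefficient≈pivot-entry : ∀ (v : Vect F n) {γ} → (∀ j → v j ≈ γ ∙ column j) → ∀ m → γ m ≈ v (pivot m)
    coefficient≈pivot-entry v {γ} v≈γM m = trans (sym (∙-column-pivot γ m)) (sym (v≈γM (pivot m)))

    pivotal? : ∀ j → Dec (Pivotal F r j)
    pivotal? j = any? (λ m → pivot m Fin.≟ j)

    vanishing-before-nonpivotal : ∀ {j} {v : Vect F n} {γ} → NonPivotal F r j → (∀ j′ → v j′ ≈ γ ∙ column j′) →
                                  (∀ j′ → j′ < j → v j′ ≈ 0#) → v j ≈ 0#
    vanishing-before-nonpivotal {j} {v} {γ} np v≈γM v<ⱼ≈0 = trans (v≈γM j) (sum-zero term≈0)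
      where
      term≈0 : ∀ i → γ i * M i j ≈ 0#
      term≈0 i with <-cmp (pivot i) j
      ... | tri< pᵢ<j _ _ = trans (*-congʳ (trans (coefficient≈pivot-entry v v≈γM i) (v<ⱼ≈0 _ pᵢ<j))) (zeroˡ _)
      ... | tri≈ _ pᵢ≡j _ = contradiction (i , pᵢ≡j) np
      ... | tri> _ _ j<pᵢ = trans (*-congˡ (leading-0 i j j<pᵢ)) (zeroʳ (γ i))

    pivotal⇒L : ∀ {j} → Pivotal F r j → LSet F X j
    pivotal⇒L (m , ≡.refl) =
      (λ j → unit m ∙ column j) , combination∈X (unit m) ,
      trans (∙-unitˡ m _) (pivot-one m) , λ j j<p → trans (∙-unitˡ m _) (leading-0 m j j<p)

    L⇒pivotal : ∀ {j} → LSet F X j → Pivotal F r j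
    L⇒pivotal {j} (v , v∈X , vⱼ≈1 , v<ⱼ≈0) with pivotal? j | ∈X⇒combination v∈X
    ... | yes p  | _         = p
    ... | no np  | γ , v≈γM  = contradiction (trans (sym (vanishing-before-nonpivotal np v≈γM v<ⱼ≈0)) vⱼ≈1) 0≉1

    ∙-unit-minus : ∀ m γ j → (λ i → unit m i - γ i) ∙ column j ≈ M m j - γ ∙ column j
    ∙-unit-minus m γ j = trans (∙-minusˡ (unit m) γ (column j)) (+-congʳ (∙-unitˡ m (column j)))

    R⇒RowInSpan : ∀ m → RSet F X (pivot m) → RowInSpan F r m (pivot m)
    R⇒RowInSpan m (v , v∈X , vₚ≈1 , v>ₚ≈0) with ∈X⇒combination v∈X
    ... | γ , v≈γM = γ′ , γ′-vanishes , row-tail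
      where
      γ′ : Vector Carrier k
      γ′ i = unit m i - γ i
      γ′-vanishes : ∀ i → ¬ i < m → γ′ i ≈ 0#
      γ′-vanishes i i≮m with <-cmp i m
      ... | tri< i<m _ _ = contradiction i<m i≮m
      ... | tri≈ _ ≡.refl _ = trans (+-cong (when-yes (m Fin.≟ m) ≡.refl)
                                            (-‿cong (trans (coefficient≈pivot-entry v v≈γM m) vₚ≈1)))
                                    (-‿inverseʳ 1#)
      ... | tri> _ _ m<i = trans (+-cong (when-no (i Fin.≟ m) (<⇒≢ m<i ∘ ≡.sym))
                                         (-‿cong (trans (coefficient≈pivot-entry v v≈γM i) (v>ₚ≈0 _ (pivot-mono m i m<i)))))
                                 (x-0≈x 0#)
      row-tail : ∀ j → pivot m < j → M m j ≈ sumF F (λ i → γ′ i * M i j)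
      row-tail j p<j = begin
        M m j                     ≈⟨ x-0≈x (M m j) ⟨
        M m j - 0#                ≈⟨ +-congˡ (-‿cong (trans (sym (v>ₚ≈0 j p<j)) (v≈γM j))) ⟩
        M m j - γ ∙ column j      ≈⟨ ∙-unit-minus m γ j ⟨
        γ′ ∙ column j             ≈⟨ sumF≈∙ γ′ (column j) ⟨
        sumF F (λ i → γ′ i * M i j) ∎

    RowInSpan⇒R : ∀ m → RowInSpan F r m (pivot m) → RSet F X (pivot m)
    RowInSpan⇒R m (γ′ , γ′-vanishes , row-tail) = (λ j → γ ∙ column j) , combination∈X γ , vₚ≈1 , v>ₚ≈0
      where
      γ : Vector Carrier k
      γ i = unit m i - γ′ i
      vₚ≈1 : γ ∙ column (pivot m) ≈ 1#
      vₚ≈1 = begin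
        γ ∙ column (pivot m)  ≈⟨ ∙-column-pivot γ m ⟩
        unit m m - γ′ m       ≈⟨ +-cong (when-yes (m Fin.≟ m) ≡.refl) (-‿cong (γ′-vanishes m (<-irrefl ≡.refl))) ⟩
        1# - 0#               ≈⟨ x-0≈x 1# ⟩
        1#                    ∎
      v>ₚ≈0 : ∀ j → pivot m < j → γ ∙ column j ≈ 0#
      v>ₚ≈0 j p<j = begin
        γ ∙ column j              ≈⟨ ∙-unit-minus m γ′ j ⟩
        M m j - γ′ ∙ column j     ≈⟨ +-congˡ (-‿cong (trans (sym (sumF≈∙ γ′ (column j))) (sym (row-tail j p<j)))) ⟩
        M m j - M m j             ≈⟨ -‿inverseʳ (M m j) ⟩
        0#                        ∎

    R⇒¬ColInSpan : ∀ {j} → NonPivotal F r j → RSet F X j → ¬ ColInSpan F r j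
    R⇒¬ColInSpan {j} np (v , v∈X , vⱼ≈1 , v>ⱼ≈0) (β , β≤ⱼ≈0 , column≈) with ∈X⇒combination v∈X
    ... | γ , v≈γM = 0≉1 (begin
        0#                           ≈⟨ sum-zero pairing-term≈0 ⟨
        β ∙ v                        ≈⟨ ∙-congˡ β v≈γM ⟩
        β ∙ (λ j′ → γ ∙ column j′)   ≈⟨ ∙-transpose β γ M ⟩
        γ ∙ (λ i → β ∙ M i)          ≈⟨ sum-cong-≋ row-pairing ⟩
        γ ∙ column j                 ≈⟨ v≈γM j ⟨
        v j                          ≈⟨ vⱼ≈1 ⟩
        1#                           ∎)
      where
      pairing-term≈0 : ∀ j′ → β j′ * v j′ ≈ 0#
      pairing-term≈0 j′ with j′ Fin.≤? j
      ... | yes j′≤j = trans (*-congʳ (β≤ⱼ≈0 j′ j′≤j)) (zeroˡ (v j′))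
      ... | no j′≰j  = trans (*-congˡ (v>ⱼ≈0 j′ (ℕ.≰⇒> j′≰j))) (zeroʳ (β j′))
      row-pairing : ∀ i → γ i * β ∙ M i ≈ γ i * M i j
      row-pairing i with <-cmp (pivot i) j
      ... | tri< pᵢ<j _ _ = *-congˡ (sym (trans (column≈ i pᵢ<j) (sumF≈∙ β (M i))))
      ... | tri≈ _ pᵢ≡j _ = contradiction (i , pᵢ≡j) np
      ... | tri> _ _ j<pᵢ = trans (*-congʳ γᵢ≈0) (trans (zeroˡ _) (sym (trans (*-congʳ γᵢ≈0) (zeroˡ _))))
        where
        γᵢ≈0 : γ i ≈ 0#
        γᵢ≈0 = trans (coefficient≈pivot-entry v v≈γM i) (v>ⱼ≈0 _ j<pᵢ)

    -- truncatedColumn j j′ is C_m[j′] padded with zeros, m being the number of pivots before j;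
    -- laterTruncatedColumns j lists C_m[j+1], …, C_m[n], with zeros in the positions j′ ≤ j.
    truncatedColumn : Fin n → Fin n → Vector Carrier k
    truncatedColumn j j′ i = when (pivot i Fin.<? j) (M i j′)

    laterTruncatedColumns : Fin n → Fin n → Vector Carrier k
    laterTruncatedColumns j j′ i = when (j Fin.<? j′) (truncatedColumn j j′ i)

    inSpan⇒ColInSpan : ∀ {j} → InSpan (laterTruncatedColumns j) (truncatedColumn j j) → ColInSpan F r j
    inSpan⇒ColInSpan {j} (β , u≈βW) = β̃ , β̃≤ⱼ≈0 , column≈
      where
      β̃ : Vector Carrier n
      β̃ j′ = when (j Fin.<? j′) (β j′)
      β̃≤ⱼ≈0 : ∀ j′ → j′ ≤ j → β̃ j′ ≈ 0#
      β̃≤ⱼ≈0 j′ j′≤j = when-no (j Fin.<? j′) (ℕ.≤⇒≯ j′≤j)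
      column≈ : ∀ i → pivot i < j → M i j ≈ sumF F (λ j′ → β̃ j′ * M i j′)
      column≈ i pᵢ<j = begin
        M i j                                    ≈⟨ when-yes (pivot i Fin.<? j) pᵢ<j ⟨
        truncatedColumn j j i                    ≈⟨ u≈βW i ⟩
        β ∙ (λ j′ → laterTruncatedColumns j j′ i) ≈⟨ sum-cong-≋ term≈ ⟩
        β̃ ∙ M i                                  ≈⟨ sumF≈∙ β̃ (M i) ⟨
        sumF F (λ j′ → β̃ j′ * M i j′)            ∎
        where
        term≈ : ∀ j′ → β j′ * laterTruncatedColumns j j′ i ≈ β̃ j′ * M i j′
        term≈ j′ = trans (*-congˡ (when-cong (j Fin.<? j′) (when-yes (pivot i Fin.<? j) pᵢ<j)))
                         (sym (when-*-comm (j Fin.<? j′) (β j′) (M i j′)))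

    separable⇒R : ∀ {j} → Separable (laterTruncatedColumns j) (truncatedColumn j j) → RSet F X j
    separable⇒R {j} (γ , γu≈1 , γW≈0) =
      (λ j′ → γ̃ ∙ column j′) , combination∈X γ̃ , trans (γ̃M≈γu j) γu≈1 , v>ⱼ≈0
      where
      γ̃ : Vector Carrier k
      γ̃ i = when (pivot i Fin.<? j) (γ i)
      γ̃M≈γu : ∀ j′ → γ̃ ∙ column j′ ≈ γ ∙ truncatedColumn j j′
      γ̃M≈γu j′ = sum-cong-≋ (λ i → when-*-comm (pivot i Fin.<? j) (γ i) (M i j′))
      v>ⱼ≈0 : ∀ j′ → j < j′ → γ̃ ∙ column j′ ≈ 0#
      v>ⱼ≈0 j′ j<j′ = begin
        γ̃ ∙ column j′                     ≈⟨ γ̃M≈γu j′ ⟩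
        γ ∙ truncatedColumn j j′          ≈⟨ ∙-congˡ γ (λ i → when-yes (j Fin.<? j′) j<j′) ⟨
        γ ∙ laterTruncatedColumns j j′    ≈⟨ γW≈0 j′ ⟩
        0#                                ∎

    ¬ColInSpan⇒R : ∀ {j} → ¬ ColInSpan F r j → RSet F X j
    ¬ColInSpan⇒R {j} ¬col =
      [ (λ inSpan → contradiction (inSpan⇒ColInSpan inSpan) ¬col) , separable⇒R ]′
        (inSpan⊎separable _≈?_ inverse n (laterTruncatedColumns j) (truncatedColumn j j))

    U⇒essential∧pivotal : ∀ {j} → PsiAt F X j U → Essential F r j × Pivotal F r j
    U⇒essential∧pivotal (l , ¬R) with L⇒pivotal l
    ... | m , ≡.refl = inj₂ (m , ≡.refl , ¬R ∘ RowInSpan⇒R m) , (m , ≡.refl)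

    essential∧pivotal⇒U : ∀ {j} → Essential F r j × Pivotal F r j → PsiAt F X j U
    essential∧pivotal⇒U (inj₁ (np , _) , p)              = contradiction p np
    essential∧pivotal⇒U (inj₂ (m , ≡.refl , ¬row) , p)  = pivotal⇒L p , ¬row ∘ R⇒RowInSpan m

    D⇒essential∧nonpivotal : ∀ {j} → PsiAt F X j D → Essential F r j × NonPivotal F r j
    D⇒essential∧nonpivotal (R , ¬L) = inj₁ (np , R⇒¬ColInSpan np R) , np
      where np = ¬L ∘ pivotal⇒L

    essential∧nonpivotal⇒D : ∀ {j} → Essential F r j × NonPivotal F r j → PsiAt F X j D
    essential∧nonpivotal⇒D (inj₁ (_ , ¬col) , np)       = ¬ColInSpan⇒R ¬col , np ∘ L⇒pivotal
    essential∧nonpivotal⇒D (inj₂ (m , pₘ≡j , _) , np)  = contradiction (m , pₘ≡j) np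

    H⇒inessential : ∀ {j} → PsiAt F X j H → Inessential F r j
    H⇒inessential (¬U , ¬D) ess@(inj₁ (np , _))      = ¬D (essential∧nonpivotal⇒D (ess , np))
    H⇒inessential (¬U , ¬D) ess@(inj₂ (m , pₘ≡j , _)) = ¬U (essential∧pivotal⇒U (ess , (m , pₘ≡j)))

    inessential⇒H : ∀ {j} → Inessential F r j → PsiAt F X j H
    inessential⇒H ¬ess = ¬ess ∘ proj₁ ∘ U⇒essential∧pivotal , ¬ess ∘ proj₁ ∘ D⇒essential∧nonpivotal

-- X is pinned down by its equivalence with the row space of M.
mainTheorem4 : ∀ {q : ℕ} {c ℓ ℓx : Level} (F : FiniteField q c ℓ) → IsPrimePower q →
    ∀ {n k : ℕ} (X : Vect F n → Set ℓx) → IsSubspace F X →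
    (M : Matrix F k n) (r : IsRREF F M) →
    (∀ v → X v ⇔ RowSpace F M v) →
    ∀ (j : Fin n) →
      (PsiAt F X j H ⇔ Inessential F r j)
      × (PsiAt F X j U ⇔ (Essential F r j × Pivotal F r j))
      × (PsiAt F X j D ⇔ (Essential F r j × NonPivotal F r j))
mainTheorem4 F _ X _ M r X⇔rowSpace j =
    mk⇔ H⇒inessential inessential⇒H
  , mk⇔ U⇒essential∧pivotal essential∧pivotal⇒U
  , mk⇔ D⇒essential∧nonpivotal essential∧nonpivotal⇒D
  where open Echelon F X r X⇔rowSpace
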